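{- For any pair $s$ and $t$ of $\{;, 1, D\}$-terms, if $\operatorname{Rel}(;, 1, D) \models s = t$ then $\operatorname{Tr}(s) = \operatorname{Tr}(t)$.
   Context: $\operatorname{Rel}(;,1,D)$ is the isomorphic closure of the class of algebras of binary relations on a common base closed under composition, containing the identity relation, and closed under domain $D(R)=\{(x,x):\exists y\,(x,y)\in R\}$. A $\Sigma$-labelled rooted tree is recursively a finite set of pairs $(a,T)$ with $a\in\Sigma$ and $T$ such a tree; a pointed tree has a distinguished vertex (the point). $T_1\le T_2$ iff there is a homomorphism $T_2\to T_1$ of labelled trees preserving root and point. The reduced form of a tree recursively reduces the child subtrees of the root and then keeps, for each label, only the $\le$-minimal child subtrees attached by that label. For reduced pointed trees, $T;S$ identifies the point of $T$ with the root of $S$ and reduces; $D(T)$ moves the point to the root and reduces. The single-tree interpretation $\operatorname{Tr}$ of $\{;,1,D\}$-terms is: $\operatorname{Tr}(a)=\vec a$ (two vertices joined by one $a$-labelled edge, point at the child), $\operatorname{Tr}(1)=$ the one-vertex pointed tree, $\operatorname{Tr}(s;t)=\operatorname{Tr}(s);\operatorname{Tr}(t)$, $\operatorname{Tr}(D(s))=D(\operatorname{Tr}(s))$. Equality of terms is literal syntactic equality. -}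

module Defs where

open import Data.Bool using (Bool; true; false; _∧_; _∨_; not; if_then_else_)
open import Data.List using (List; []; _∷_; _++_; map)
open import Data.Product using (Σ; _×_; _,_; ∃)
open import Data.Sum using (_⊎_)
open import Data.Unit using (⊤)
open import Data.Empty using (⊥)
open import Relation.Binary.PropositionalEquality using (_≡_)
open import Relation.Binary.Definitions using (DecidableEquality)
open import Relation.Nullary.Decidable using (⌊_⌋)

data Term (A : Set) : Set where
  var : A → Term A
  _⨾_ : Term A → Term A → Term A
  one : Term A
  D   : Term A → Term A

BinRel : Set → Set₁
BinRel X = X → X → Set

⟦_⟧ : {A X : Set} → Term A → (A → BinRel X) → BinRel X
⟦ var a ⟧ v x y = v a x y
⟦ s ⨾ t ⟧ v x y = ∃ λ z → ⟦ s ⟧ v x z × ⟦ t ⟧ v z y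
⟦ one ⟧   v x y = x ≡ y
⟦ D s ⟧   v x y = x ≡ y × ∃ λ z → ⟦ s ⟧ v x z

-- Rel(;,1,D) ⊨ s = t : in every algebra of binary relations on a base X
-- (under every assignment of relations to the variables) s and t denote
-- the same relation.  (Isomorphic closure does not affect validity.)
RelValid : {A : Set} → Term A → Term A → Set₁
RelValid {A} s t =
  (X : Set) (v : A → BinRel X) (x y : X) →
  (⟦ s ⟧ v x y → ⟦ t ⟧ v x y) × (⟦ t ⟧ v x y → ⟦ s ⟧ v x y)

-- Labelled rooted trees with an optional point.
-- node b cs : a vertex (b = true iff it is the point) with the finite
-- set of labelled children cs (a list read as a finite set).

data Tree (A : Set) : Set where
  node : Bool → List (A × Tree A) → Tree A

module Trees {A : Set} (_≟_ : DecidableEquality A) where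

  -- Equality of trees as (hereditarily finite) sets, with the point.
  mutual
    _≈_ : Tree A → Tree A → Set
    node b cs ≈ node b' ds = (b ≡ b') × (SubC cs ds × SubC ds cs)

    SubC : List (A × Tree A) → List (A × Tree A) → Set
    SubC [] ds = ⊤
    SubC ((a , c) ∷ cs) ds = InC a c ds × SubC cs ds

    InC : A → Tree A → List (A × Tree A) → Set
    InC a c [] = ⊥
    InC a c ((a' , d) ∷ ds) = ((a ≡ a') × (c ≈ d)) ⊎ InC a c ds

  infix 4 _≈_

  -- hom S T = true iff there is a homomorphism of labelled trees S → T
  -- preserving the root and mapping the point (if any) to the point.
  _⇒_ : Bool → Bool → Bool
  true ⇒ b = b
  false ⇒ b = true

  mutual
    hom : Tree A → Tree A → Bool
    hom (node b cs) (node b' ds) = (b ⇒ b') ∧ homAll cs ds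

    homAll : List (A × Tree A) → List (A × Tree A) → Bool
    homAll [] ds = true
    homAll ((a , c) ∷ cs) ds = homAny a c ds ∧ homAll cs ds

    homAny : A → Tree A → List (A × Tree A) → Bool
    homAny a c [] = false
    homAny a c ((a' , d) ∷ ds) = (⌊ a ≟ a' ⌋ ∧ hom c d) ∨ homAny a c ds

  _≤ᵇ_ : Tree A → Tree A → Bool
  T₁ ≤ᵇ T₂ = hom T₂ T₁

  minimal : A × Tree A → List (A × Tree A) → Bool
  minimal (a , c) [] = true
  minimal (a , c) ((a' , c') ∷ cs) =
    not (⌊ a ≟ a' ⌋ ∧ (c' ≤ᵇ c) ∧ not (c ≤ᵇ c')) ∧ minimal (a , c) cs

  keepMin : List (A × Tree A) → List (A × Tree A) → List (A × Tree A)
  keepMin [] all = []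
  keepMin (x ∷ xs) all = if minimal x all then x ∷ keepMin xs all else keepMin xs all

  mutual
    reduce : Tree A → Tree A
    reduce (node b cs) = let cs' = reduceCs cs in node b (keepMin cs' cs')

    reduceCs : List (A × Tree A) → List (A × Tree A)
    reduceCs [] = []
    reduceCs ((a , c) ∷ cs) = (a , reduce c) ∷ reduceCs cs

  -- identify the point of T with the root of S (unreduced)
  mutual
    glue : Tree A → Tree A → Tree A
    glue (node true cs) (node b ds) = node b (cs ++ ds)
    glue (node false cs) S = node false (glueCs cs S)

    glueCs : List (A × Tree A) → Tree A → List (A × Tree A)
    glueCs [] S = []
    glueCs ((a , c) ∷ cs) S = (a , glue c S) ∷ glueCs cs S

  mutual
    unpoint : Tree A → Tree A
    unpoint (node b cs) = node false (unpointCs cs)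

    unpointCs : List (A × Tree A) → List (A × Tree A)
    unpointCs [] = []
    unpointCs ((a , c) ∷ cs) = (a , unpoint c) ∷ unpointCs cs

  _⨟_ : Tree A → Tree A → Tree A
  T ⨟ S = reduce (glue T S)

  Dᵗ : Tree A → Tree A
  Dᵗ (node b cs) = reduce (node true (unpointCs cs))

  Tr : Term A → Tree A
  Tr (var a) = node false ((a , node true []) ∷ [])
  Tr one = node true []
  Tr (s ⨾ t) = Tr s ⨟ Tr t
  Tr (D s) = Dᵗ (Tr s)

-- The proof is the canonical-model argument.
--  * Homomorphisms of labelled trees form a preorder, and reduction does
--    not change the homomorphism-equivalence class of a tree.
--  * Every Tr s has exactly one point and is reduced, and two reduced
--    trees with homomorphisms both ways are equal.
--  * In a relational model a tree T denotes the relation "some homomorphic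
--    image of T has its root at x and its point at y"; the relation denoted
--    by a term s is exactly the one denoted by Tr s.
--  * In the canonical model, whose elements are trees and where a relates
--    a tree to its a-children, Tr s relates itself to its point; any image
--    of Tr t with root Tr s and point a point is a homomorphism Tr t → Tr s.
-- Validity of s = t thus gives homomorphisms both ways between the reduced
-- trees Tr s and Tr t, which are therefore equal.
module Submission where

open import Defs
open import Relation.Binary.Definitions using (DecidableEquality)
open import Data.Bool using (Bool; true; false; _∧_; _∨_; not)
open import Data.Bool.Properties using (∧-conicalˡ; ∧-conicalʳ; ∧-zeroʳ; ∨-zeroʳ; T-≡)
open import Data.List using (List; []; _∷_; _++_)
open import Data.List.Relation.Unary.Any using (Any; here; there)
open import Data.List.Membership.Propositional using (_∈_; lose)
open import Data.Product using (_×_; _,_; ∃; proj₁; proj₂)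
open import Data.Sum using (_⊎_; inj₁; inj₂)
open import Data.Unit using (⊤; tt)
open import Data.Empty using (⊥; ⊥-elim)
open import Relation.Binary.PropositionalEquality
  using (_≡_; refl; sym; trans; cong; cong₂; subst)
open import Relation.Nullary.Decidable using (⌊_⌋; toWitness; fromWitness)
open import Function.Bundles using (Equivalence)

RelValid-sym : ∀ {A} (s t : Term A) → RelValid s t → RelValid t s
RelValid-sym s t valid X v x y = let to , from = valid X v x y in from , to

module SingleTree {A : Set} (_≟_ : DecidableEquality A) where
  open Trees _≟_

  Child : Set
  Child = A × Tree A

  ∧-fst : ∀ {a b} → a ∧ b ≡ true → a ≡ true
  ∧-fst = ∧-conicalˡ _ _

  ∧-snd : ∀ {a b} → a ∧ b ≡ true → b ≡ true
  ∧-snd = ∧-conicalʳ _ _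

  ∧-intro : ∀ {a b} → a ≡ true → b ≡ true → a ∧ b ≡ true
  ∧-intro refl refl = refl

  not-true : ∀ {a} → not a ≡ true → a ≡ false
  not-true {false} _ = refl

  ∨-elim : ∀ {a b} → a ∨ b ≡ true → a ≡ true ⊎ b ≡ true
  ∨-elim {true} _ = inj₁ refl
  ∨-elim {false} p = inj₂ p

  ∨-introˡ : ∀ {a b} → a ≡ true → a ∨ b ≡ true
  ∨-introˡ refl = refl

  ∨-introʳ : ∀ {a b} → b ≡ true → a ∨ b ≡ true
  ∨-introʳ {a} refl = ∨-zeroʳ a

  ≟-sound : ∀ {a a'} → ⌊ a ≟ a' ⌋ ≡ true → a ≡ a'
  ≟-sound {a} {a'} p = toWitness {a? = a ≟ a'} (Equivalence.from T-≡ p)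

  ≟-refl : ∀ a → ⌊ a ≟ a ⌋ ≡ true
  ≟-refl a = Equivalence.to T-≡ (fromWitness {a? = a ≟ a} refl)

  ⇒-refl : ∀ b → b ⇒ b ≡ true
  ⇒-refl true = refl
  ⇒-refl false = refl

  ⇒-trans : ∀ a b c → a ⇒ b ≡ true → b ⇒ c ≡ true → a ⇒ c ≡ true
  ⇒-trans true true c _ q = q
  ⇒-trans false b c _ _ = refl

  ⇒-mp : ∀ a b → a ⇒ b ≡ true → a ≡ true → b ≡ true
  ⇒-mp true b p _ = p

  ⇒-antisym : ∀ a b → a ⇒ b ≡ true → b ⇒ a ≡ true → a ≡ b
  ⇒-antisym true true _ _ = refl
  ⇒-antisym false false _ _ = refl
  ⇒-antisym true false () _
  ⇒-antisym false true _ ()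

  homAny-intro : ∀ {a c d ds} → (a , d) ∈ ds → hom c d ≡ true → homAny a c ds ≡ true
  homAny-intro {a} (here refl) h = ∨-introˡ (∧-intro (≟-refl a) h)
  homAny-intro (there m) h = ∨-introʳ (homAny-intro m h)

  homAny-witness : ∀ {a c} ds → homAny a c ds ≡ true → ∃ λ d → (a , d) ∈ ds × hom c d ≡ true
  homAny-witness [] ()
  homAny-witness ((a' , d) ∷ ds) h with ∨-elim h
  ... | inj₁ q rewrite ≟-sound (∧-fst q) = d , here refl , ∧-snd q
  ... | inj₂ q = let d' , m , k = homAny-witness ds q in d' , there m , k

  homAll-∈ : ∀ cs {a c ds} → homAll cs ds ≡ true → (a , c) ∈ cs → homAny a c ds ≡ true
  homAll-∈ (_ ∷ cs) h (here refl) = ∧-fst h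
  homAll-∈ (_ ∷ cs) h (there m) = homAll-∈ cs (∧-snd h) m

  mutual
    hom-refl : ∀ T → hom T T ≡ true
    hom-refl (node b cs) = ∧-intro (⇒-refl b) (homAll-⊆ cs (λ m → m))

    homAll-⊆ : ∀ xs {ds} → (∀ {x} → x ∈ xs → x ∈ ds) → homAll xs ds ≡ true
    homAll-⊆ [] f = refl
    homAll-⊆ ((a , c) ∷ xs) f =
      ∧-intro (homAny-intro (f (here refl)) (hom-refl c)) (homAll-⊆ xs (λ m → f (there m)))

  mutual
    hom-trans : ∀ R S T → hom R S ≡ true → hom S T ≡ true → hom R T ≡ true
    hom-trans (node b cs) (node b' ds) (node b'' es) h₁ h₂ =
      ∧-intro (⇒-trans b b' b'' (∧-fst h₁) (∧-fst h₂))
              (homAll-trans cs ds es (∧-snd h₁) (∧-snd h₂))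

    homAll-trans : ∀ cs ds es → homAll cs ds ≡ true → homAll ds es ≡ true → homAll cs es ≡ true
    homAll-trans [] ds es _ _ = refl
    homAll-trans ((a , c) ∷ cs) ds es h₁ h₂ =
      ∧-intro (homAny-trans a c ds es (∧-fst h₁) h₂) (homAll-trans cs ds es (∧-snd h₁) h₂)

    homAny-trans : ∀ a c ds es → homAny a c ds ≡ true → homAll ds es ≡ true → homAny a c es ≡ true
    homAny-trans a c [] es () _
    homAny-trans a c ((a' , d) ∷ ds) es h₁ h₂ with ∨-elim h₁
    ... | inj₁ q = homAny-precomp a c d es (∧-snd q)
                     (subst (λ z → homAny z d es ≡ true) (sym (≟-sound (∧-fst q))) (∧-fst h₂))
    ... | inj₂ q = homAny-trans a c ds es q (∧-snd h₂)

    homAny-precomp : ∀ a c d es → hom c d ≡ true → homAny a d es ≡ true → homAny a c es ≡ true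
    homAny-precomp a c d [] _ ()
    homAny-precomp a c d ((a' , e) ∷ es) h k with ∨-elim k
    ... | inj₁ q = ∨-introˡ (∧-intro (∧-fst {⌊ a ≟ a' ⌋} q) (hom-trans c d e h (∧-snd q)))
    ... | inj₂ q = ∨-introʳ (homAny-precomp a c d es h q)

  strictlyBelow : Child → Child → Bool
  strictlyBelow (a , c) (a' , c') = ⌊ a ≟ a' ⌋ ∧ (c' ≤ᵇ c) ∧ not (c ≤ᵇ c')

  minimal-∈ : ∀ {x L y} → minimal x L ≡ true → y ∈ L → strictlyBelow x y ≡ false
  minimal-∈ {a , c} {_ ∷ L} h (here refl) = not-true (∧-fst h)
  minimal-∈ {a , c} {_ ∷ L} h (there m) = minimal-∈ (∧-snd h) m

  ∈-minimal : ∀ x L → (∀ {y} → y ∈ L → strictlyBelow x y ≡ false) → minimal x L ≡ true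
  ∈-minimal (a , c) [] f = refl
  ∈-minimal (a , c) (y ∷ L) f =
    ∧-intro (cong not (f (here refl))) (∈-minimal (a , c) L (λ m → f (there m)))

  conj-false-if-r : ∀ p q {r} → r ≡ true → p ∧ q ∧ not r ≡ false
  conj-false-if-r p q refl = trans (cong (p ∧_) (∧-zeroʳ q)) (∧-zeroʳ p)

  conj-false-if-¬q : ∀ p {q} r → q ≡ false → p ∧ q ∧ r ≡ false
  conj-false-if-¬q p r refl = ∧-zeroʳ p

  r-if-conj-false : ∀ {p q r} → p ≡ true → q ≡ true → p ∧ q ∧ not r ≡ false → r ≡ true
  r-if-conj-false {r = true} _ _ _ = refl
  r-if-conj-false {r = false} refl refl ()

  notBelow-if-≤ : ∀ {a a'} c c' → hom c' c ≡ true → strictlyBelow (a , c) (a' , c') ≡ false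
  notBelow-if-≤ {a} {a'} c c' = conj-false-if-r ⌊ a ≟ a' ⌋ (hom c c')

  notBelow-if-≰ : ∀ {a a'} c c' → hom c c' ≡ false → strictlyBelow (a , c) (a' , c') ≡ false
  notBelow-if-≰ {a} {a'} c c' = conj-false-if-¬q ⌊ a ≟ a' ⌋ (not (hom c' c))

  ≤-if-notBelow : ∀ {a} c c' → hom c c' ≡ true → strictlyBelow (a , c) (a , c') ≡ false →
                  hom c' c ≡ true
  ≤-if-notBelow {a} c c' = r-if-conj-false (≟-refl a)

  keepMin-⊆ : ∀ {x} xs L → x ∈ keepMin xs L → x ∈ xs
  keepMin-⊆ (y ∷ xs) L m with minimal y L
  keepMin-⊆ (y ∷ xs) L (here e) | true = here e
  keepMin-⊆ (y ∷ xs) L (there m) | true = there (keepMin-⊆ xs L m)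
  keepMin-⊆ (y ∷ xs) L m | false = there (keepMin-⊆ xs L m)

  keepMin-minimal : ∀ {x} xs L → x ∈ keepMin xs L → minimal x L ≡ true
  keepMin-minimal (y ∷ xs) L m with minimal y L in eq
  keepMin-minimal (y ∷ xs) L (here refl) | true = eq
  keepMin-minimal (y ∷ xs) L (there m) | true = keepMin-minimal xs L m
  keepMin-minimal (y ∷ xs) L m | false = keepMin-minimal xs L m

  keepMin-∈ : ∀ {x} xs L → x ∈ xs → minimal x L ≡ true → x ∈ keepMin xs L
  keepMin-∈ (y ∷ xs) L (here refl) mn rewrite mn = here refl
  keepMin-∈ (y ∷ xs) L (there m) mn with minimal y L
  ... | true = there (keepMin-∈ xs L m mn)
  ... | false = keepMin-∈ xs L m mn

  -- Below any candidate e for an a-child there is a child that is minimal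
  -- in L: either e itself or an a-child of L.  (L is finite, so
  -- descending along strictlyBelow terminates.)
  minimal-below : ∀ L a e →
    ∃ λ m → (m ≡ e ⊎ (a , m) ∈ L) × hom e m ≡ true × minimal (a , m) L ≡ true
  minimal-below [] a e = e , inj₁ refl , hom-refl e , refl
  minimal-below ((a' , l) ∷ L) a e with minimal-below L a e
  ... | m , m∈ , em , mn with strictlyBelow (a , m) (a' , l) in below
  ...   | false = m , weaken m∈ , em , ∧-intro (cong not below) mn
    where
      weaken : (m ≡ e) ⊎ ((a , m) ∈ L) → (m ≡ e) ⊎ ((a , m) ∈ ((a' , l) ∷ L))
      weaken (inj₁ x) = inj₁ x
      weaken (inj₂ x) = inj₂ (there x)
  ...   | true with minimal-below L a l
  ...     | m' , m'∈ , lm' , mn' =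
            m' , weaken m'∈ , hom-trans e m m' em (hom-trans m l m' ml lm') ,
            ∧-intro (cong not (notBelow-if-≤ m' l lm')) mn'
    where
      ml : hom m l ≡ true
      ml = ∧-fst (∧-snd {⌊ a ≟ a' ⌋} below)
      weaken : (m' ≡ l) ⊎ ((a , m') ∈ L) → (m' ≡ e) ⊎ ((a , m') ∈ ((a' , l) ∷ L))
      weaken (inj₁ x) = inj₂ (here (cong₂ _,_ (≟-sound (∧-fst below)) x))
      weaken (inj₂ x) = inj₂ (there x)

  reduceCs-∈ : ∀ cs {a c} → (a , c) ∈ cs → (a , reduce c) ∈ reduceCs cs
  reduceCs-∈ (_ ∷ cs) (here refl) = here refl
  reduceCs-∈ (_ ∷ cs) (there m) = there (reduceCs-∈ cs m)

  homAll-keepMin : ∀ xs L {ds} → homAll xs ds ≡ true → homAll (keepMin xs L) ds ≡ true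
  homAll-keepMin [] L h = refl
  homAll-keepMin ((a , c) ∷ xs) L h with minimal (a , c) L
  ... | true = ∧-intro (∧-fst h) (homAll-keepMin xs L (∧-snd h))
  ... | false = homAll-keepMin xs L (∧-snd h)

  mutual
    hom-from-reduce : ∀ T → hom (reduce T) T ≡ true
    hom-from-reduce (node b cs) =
      ∧-intro (⇒-refl b) (homAll-keepMin (reduceCs cs) (reduceCs cs) (homAll-from-reduceCs cs (λ m → m)))

    homAll-from-reduceCs : ∀ cs {ds} → (∀ {x} → x ∈ cs → x ∈ ds) →
                           homAll (reduceCs cs) ds ≡ true
    homAll-from-reduceCs [] f = refl
    homAll-from-reduceCs ((a , c) ∷ cs) f =
      ∧-intro (homAny-intro (f (here refl)) (hom-from-reduce c))
              (homAll-from-reduceCs cs (λ m → f (there m)))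

  mutual
    -- Each child of T maps into its reduct, and on into a minimal one.
    hom-into-reduce : ∀ T → hom T (reduce T) ≡ true
    hom-into-reduce (node b cs) =
      ∧-intro (⇒-refl b) (homAll-into-keepMin cs (reduceCs cs) (reduceCs-∈ cs))

    homAll-into-keepMin : ∀ xs L → (∀ {a c} → (a , c) ∈ xs → (a , reduce c) ∈ L) →
                          homAll xs (keepMin L L) ≡ true
    homAll-into-keepMin [] L f = refl
    homAll-into-keepMin ((a , c) ∷ xs) L f with minimal-below L a (reduce c)
    ... | m , m∈ , em , mn =
      ∧-intro (homAny-intro (keepMin-∈ L L (inL m∈) mn) (hom-trans c (reduce c) m (hom-into-reduce c) em))
              (homAll-into-keepMin xs L (λ m → f (there m)))
      where
        inL : (m ≡ reduce c) ⊎ ((a , m) ∈ L) → (a , m) ∈ L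
        inL (inj₁ e) = subst (λ z → (a , z) ∈ L) (sym e) (f (here refl))
        inL (inj₂ m) = m

  mutual
    data Unpointed : Tree A → Set where
      unpointed : ∀ {cs} → UnpointedCs cs → Unpointed (node false cs)

    data UnpointedCs : List Child → Set where
      [] : UnpointedCs []
      _∷_ : ∀ {a c cs} → Unpointed c → UnpointedCs cs → UnpointedCs ((a , c) ∷ cs)

  mutual
    data Pointed : Tree A → Set where
      at-root : ∀ {cs} → UnpointedCs cs → Pointed (node true cs)
      below-root : ∀ {cs} → PointedCs cs → Pointed (node false cs)

    data PointedCs : List Child → Set where
      here : ∀ {a c cs} → Pointed c → UnpointedCs cs → PointedCs ((a , c) ∷ cs)
      there : ∀ {a c cs} → Unpointed c → PointedCs cs → PointedCs ((a , c) ∷ cs)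

  mutual
    unpoint-unpointed : ∀ T → Unpointed (unpoint T)
    unpoint-unpointed (node b cs) = unpointed (unpointCs-unpointed cs)

    unpointCs-unpointed : ∀ cs → UnpointedCs (unpointCs cs)
    unpointCs-unpointed [] = []
    unpointCs-unpointed ((a , c) ∷ cs) = unpoint-unpointed c ∷ unpointCs-unpointed cs

  mutual
    unpoint-id : ∀ {T} → Unpointed T → unpoint T ≡ T
    unpoint-id (unpointed u) = cong (node false) (unpointCs-id u)

    unpointCs-id : ∀ {cs} → UnpointedCs cs → unpointCs cs ≡ cs
    unpointCs-id [] = refl
    unpointCs-id (_∷_ {a} u us) = cong₂ (λ c cs → (a , c) ∷ cs) (unpoint-id u) (unpointCs-id us)

  mutual
    glue-id : ∀ {T} S → Unpointed T → glue T S ≡ T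
    glue-id S (unpointed u) = cong (node false) (glueCs-id S u)

    glueCs-id : ∀ {cs} S → UnpointedCs cs → glueCs cs S ≡ cs
    glueCs-id S [] = refl
    glueCs-id S (_∷_ {a} u us) = cong₂ (λ c cs → (a , c) ∷ cs) (glue-id S u) (glueCs-id S us)

  unpointedCs-∈ : ∀ {cs a c} → UnpointedCs cs → (a , c) ∈ cs → Unpointed c
  unpointedCs-∈ (u ∷ _) (here refl) = u
  unpointedCs-∈ (_ ∷ us) (there m) = unpointedCs-∈ us m

  mutual
    pointed-unpointed : ∀ {c} → Pointed c → Unpointed c → ⊥
    pointed-unpointed (below-root p) (unpointed u) = pointedCs-unpointedCs p u

    pointedCs-unpointedCs : ∀ {cs} → PointedCs cs → UnpointedCs cs → ⊥
    pointedCs-unpointedCs (here p _) (u ∷ _) = pointed-unpointed p u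
    pointedCs-unpointedCs (there _ p) (_ ∷ u) = pointedCs-unpointedCs p u

  mutual
    no-hom-pointed-unpointed : ∀ {c c'} → Pointed c → Unpointed c' → hom c c' ≡ false
    no-hom-pointed-unpointed (at-root _) (unpointed _) = refl
    no-hom-pointed-unpointed (below-root p) (unpointed u) = no-homAll-pointed-unpointed p u

    no-homAll-pointed-unpointed : ∀ {cs ds} → PointedCs cs → UnpointedCs ds → homAll cs ds ≡ false
    no-homAll-pointed-unpointed (here {a} {c} p _) u = cong (_∧ _) (no-homAny-pointed-unpointed a c p u)
    no-homAll-pointed-unpointed {ds = ds} (there {a} {c} _ p) u =
      trans (cong (homAny a c ds ∧_) (no-homAll-pointed-unpointed p u)) (∧-zeroʳ (homAny a c ds))

    no-homAny-pointed-unpointed : ∀ a c {ds} → Pointed c → UnpointedCs ds → homAny a c ds ≡ false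
    no-homAny-pointed-unpointed a c p [] = refl
    no-homAny-pointed-unpointed a c p (_∷_ {a'} u us) =
      cong₂ _∨_ (trans (cong (⌊ a ≟ a' ⌋ ∧_) (no-hom-pointed-unpointed p u)) (∧-zeroʳ _))
                (no-homAny-pointed-unpointed a c p us)

  keepMin-unpointed : ∀ xs L → UnpointedCs xs → UnpointedCs (keepMin xs L)
  keepMin-unpointed [] L [] = []
  keepMin-unpointed ((a , c) ∷ xs) L (u ∷ us) with minimal (a , c) L
  ... | true = u ∷ keepMin-unpointed xs L us
  ... | false = keepMin-unpointed xs L us

  pointedCs-members : ∀ {L} → PointedCs L →
    ∃ λ c₀ → ∀ {a' c'} → (a' , c') ∈ L → Unpointed c' ⊎ c' ≡ c₀
  pointedCs-members (here {c = c} p us) =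
    c , λ { (here refl) → inj₂ refl ; (there m) → inj₁ (unpointedCs-∈ us m) }
  pointedCs-members (there u p) =
    let c₀ , f = pointedCs-members p in c₀ , λ { (here refl) → inj₁ u ; (there m) → f m }

  -- The pointed child is minimal among its siblings: the unpointed ones do
  -- not lie below it, and it is the only pointed one.  So reduction never
  -- drops it.
  pointed-child-minimal : ∀ {L a c} → PointedCs L → (a , c) ∈ L → Pointed c →
                          minimal (a , c) L ≡ true
  pointed-child-minimal {L} {a} {c} pL m pc with pointedCs-members pL
  ... | c₀ , f = ∈-minimal (a , c) L notBelow
    where
      c≡c₀ : c ≡ c₀
      c≡c₀ with f m
      ... | inj₁ u = ⊥-elim (pointed-unpointed pc u)
      ... | inj₂ e = e
      notBelow : ∀ {y} → y ∈ L → strictlyBelow (a , c) y ≡ false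
      notBelow {_ , c'} m' with f m'
      ... | inj₁ u = notBelow-if-≰ c c' (no-hom-pointed-unpointed pc u)
      ... | inj₂ e =
        notBelow-if-≤ c c' (subst (λ z → hom z c ≡ true) (trans c≡c₀ (sym e)) (hom-refl c))

  keepMin-pointed : ∀ xs L → PointedCs xs →
                    (∀ {a c} → (a , c) ∈ xs → Pointed c → minimal (a , c) L ≡ true) →
                    PointedCs (keepMin xs L)
  keepMin-pointed ((a , c) ∷ xs) L (here p us) f rewrite f (here refl) p = here p (keepMin-unpointed xs L us)
  keepMin-pointed ((a , c) ∷ xs) L (there u p) f with minimal (a , c) L
  ... | true = there u (keepMin-pointed xs L p (λ m → f (there m)))
  ... | false = keepMin-pointed xs L p (λ m → f (there m))

  mutual
    reduce-unpointed : ∀ {T} → Unpointed T → Unpointed (reduce T)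
    reduce-unpointed (unpointed {cs} u) =
      unpointed (keepMin-unpointed (reduceCs cs) (reduceCs cs) (reduceCs-unpointed u))

    reduceCs-unpointed : ∀ {cs} → UnpointedCs cs → UnpointedCs (reduceCs cs)
    reduceCs-unpointed [] = []
    reduceCs-unpointed (u ∷ us) = reduce-unpointed u ∷ reduceCs-unpointed us

  mutual
    reduce-pointed : ∀ {T} → Pointed T → Pointed (reduce T)
    reduce-pointed (at-root {cs} us) =
      at-root (keepMin-unpointed (reduceCs cs) (reduceCs cs) (reduceCs-unpointed us))
    reduce-pointed (below-root {cs} p) =
      below-root (keepMin-pointed (reduceCs cs) (reduceCs cs) p' (pointed-child-minimal p'))
      where
        p' : PointedCs (reduceCs cs)
        p' = reduceCs-pointed p

    reduceCs-pointed : ∀ {cs} → PointedCs cs → PointedCs (reduceCs cs)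
    reduceCs-pointed (here p us) = here (reduce-pointed p) (reduceCs-unpointed us)
    reduceCs-pointed (there u p) = there (reduce-unpointed u) (reduceCs-pointed p)

  ++-unpointed : ∀ {cs ds} → UnpointedCs cs → UnpointedCs ds → UnpointedCs (cs ++ ds)
  ++-unpointed [] vs = vs
  ++-unpointed (u ∷ us) vs = u ∷ ++-unpointed us vs

  ++-pointed : ∀ {cs ds} → UnpointedCs cs → PointedCs ds → PointedCs (cs ++ ds)
  ++-pointed [] p = p
  ++-pointed (u ∷ us) p = there u (++-pointed us p)

  mutual
    glue-pointed : ∀ {T S} → Pointed T → Pointed S → Pointed (glue T S)
    glue-pointed (at-root us) (at-root vs) = at-root (++-unpointed us vs)
    glue-pointed (at-root us) (below-root p) = below-root (++-pointed us p)
    glue-pointed (below-root p) pS = below-root (glueCs-pointed p pS)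

    glueCs-pointed : ∀ {cs S} → PointedCs cs → Pointed S → PointedCs (glueCs cs S)
    glueCs-pointed {S = S} (here p us) pS =
      here (glue-pointed p pS) (subst UnpointedCs (sym (glueCs-id S us)) us)
    glueCs-pointed {S = S} (there u p) pS = there (subst Unpointed (sym (glue-id S u)) u) (glueCs-pointed p pS)

  Tr-pointed : ∀ s → Pointed (Tr s)
  Tr-pointed (var a) = below-root (here (at-root []) [])
  Tr-pointed (s ⨾ t) = reduce-pointed (glue-pointed (Tr-pointed s) (Tr-pointed t))
  Tr-pointed one = at-root []
  Tr-pointed (D s) with Tr s
  ... | node b cs = reduce-pointed (at-root (unpointCs-unpointed cs))

  mutual
    Reduced : Tree A → Set
    Reduced (node b cs) = ReducedCs cs × (∀ {x} → x ∈ cs → minimal x cs ≡ true)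

    ReducedCs : List Child → Set
    ReducedCs [] = ⊤
    ReducedCs ((a , c) ∷ cs) = Reduced c × ReducedCs cs

  keepMin-reduced : ∀ xs L → ReducedCs xs → ReducedCs (keepMin xs L)
  keepMin-reduced [] L r = tt
  keepMin-reduced ((a , c) ∷ xs) L (rc , rs) with minimal (a , c) L
  ... | true = rc , keepMin-reduced xs L rs
  ... | false = keepMin-reduced xs L rs

  minimal-⊆ : ∀ x L K → minimal x L ≡ true → (∀ {y} → y ∈ K → y ∈ L) →
              minimal x K ≡ true
  minimal-⊆ x L K h sub = ∈-minimal x K (λ m → minimal-∈ h (sub m))

  mutual
    reduce-reduced : ∀ T → Reduced (reduce T)
    reduce-reduced (node b cs) =
      keepMin-reduced L L (reduceCs-reduced cs) ,
      λ {x} m → minimal-⊆ x L (keepMin L L) (keepMin-minimal L L m) (keepMin-⊆ L L)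
      where
        L : List Child
        L = reduceCs cs

    reduceCs-reduced : ∀ cs → ReducedCs (reduceCs cs)
    reduceCs-reduced [] = tt
    reduceCs-reduced ((a , c) ∷ cs) = reduce-reduced c , reduceCs-reduced cs

  singleton-minimal : ∀ x → minimal x (x ∷ []) ≡ true
  singleton-minimal (a , c) = ∈-minimal (a , c) ((a , c) ∷ []) notBelow
    where
      notBelow : ∀ {y} → y ∈ (a , c) ∷ [] → strictlyBelow (a , c) y ≡ false
      notBelow (here refl) = notBelow-if-≤ c c (hom-refl c)

  Tr-reduced : ∀ s → Reduced (Tr s)
  Tr-reduced (var a) = ((tt , λ ()) , tt) , λ { (here refl) → singleton-minimal (a , node true []) }
  Tr-reduced (s ⨾ t) = reduce-reduced (glue (Tr s) (Tr t))
  Tr-reduced one = tt , λ ()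
  Tr-reduced (D s) with Tr s
  ... | node b cs = reduce-reduced (node true (unpointCs cs))

  EquivChild : A → Tree A → Child → Set
  EquivChild a c (a' , d) = a ≡ a' × hom c d ≡ true × hom d c ≡ true

  -- If the children cs and ds map into each other, a minimal child (a , c)
  -- of cs has an equivalent a-child in ds: c maps into some d, which maps
  -- into some c' ≤ c, and minimality of c forces c ≤ c' ≤ d.
  equivalent-child : ∀ {a c cs ds} → (a , c) ∈ cs → minimal (a , c) cs ≡ true →
    homAll cs ds ≡ true → homAll ds cs ≡ true → Any (EquivChild a c) ds
  equivalent-child {a} {c} {cs} {ds} c∈ mn h₁ h₂ =
    let d , d∈ , cd = homAny-witness ds (homAll-∈ cs h₁ c∈)
        c' , c'∈ , dc' = homAny-witness cs (homAll-∈ ds h₂ d∈)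
        c'c = ≤-if-notBelow c c' (hom-trans c d c' cd dc') (minimal-∈ mn c'∈)
    in lose d∈ (refl , cd , hom-trans d c' c dc' c'c)

  mutual
    hom-equivalent-reduced : ∀ S T → Reduced S → Reduced T →
                             hom S T ≡ true → hom T S ≡ true → S ≈ T
    hom-equivalent-reduced (node b cs) (node b' ds) (rcs , mcs) (rds , mds) h₁ h₂ =
      ⇒-antisym b b' (∧-fst h₁) (∧-fst h₂) ,
      children-match cs rcs rds mcs (∧-snd h₁) (∧-snd h₂) (λ m → m) ,
      children-match ds rds rcs mds (∧-snd h₂) (∧-snd h₁) (λ m → m)

    children-match : ∀ xs {cs ds} → ReducedCs xs → ReducedCs ds →
      (∀ {x} → x ∈ cs → minimal x cs ≡ true) → homAll cs ds ≡ true → homAll ds cs ≡ true →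
      (∀ {x} → x ∈ xs → x ∈ cs) → SubC xs ds
    children-match [] _ _ _ _ _ _ = tt
    children-match ((a , c) ∷ xs) {ds = ds} (rc , rxs) rds mcs h₁ h₂ sub =
      equal-child ds rc rds (equivalent-child (sub (here refl)) (mcs (sub (here refl))) h₁ h₂) ,
      children-match xs rxs rds mcs h₁ h₂ (λ m → sub (there m))

    equal-child : ∀ {a c} ds → Reduced c → ReducedCs ds → Any (EquivChild a c) ds → InC a c ds
    equal-child {c = c} ((_ , d) ∷ ds) rc (rd , _) (here (refl , cd , dc)) =
      inj₁ (refl , hom-equivalent-reduced c d rc rd cd dc)
    equal-child (_ ∷ ds) rc (_ , rds) (there p) = inj₂ (equal-child ds rc rds p)

  module Semantics {X : Set} (v : A → BinRel X) where

    -- Sat T x y: T has a homomorphic image with root x and point y.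
    mutual
      Sat : Tree A → X → X → Set
      Sat (node b cs) x y = (b ≡ true → x ≡ y) × SatCs cs x y

      SatCs : List Child → X → X → Set
      SatCs [] x y = ⊤
      SatCs ((a , c) ∷ cs) x y = (∃ λ z → v a x z × Sat c z y) × SatCs cs x y

    mutual
      Sat-hom : ∀ S T {x y} → hom S T ≡ true → Sat T x y → Sat S x y
      Sat-hom (node b cs) (node b' ds) h (pt , sat) =
        (λ e → pt (⇒-mp b b' (∧-fst h) e)) , SatCs-hom cs ds (∧-snd h) sat

      SatCs-hom : ∀ cs ds {x y} → homAll cs ds ≡ true → SatCs ds x y → SatCs cs x y
      SatCs-hom [] ds _ _ = tt
      SatCs-hom ((a , c) ∷ cs) ds h sat = SatAny-hom a c ds (∧-fst h) sat , SatCs-hom cs ds (∧-snd h) sat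

      SatAny-hom : ∀ a c ds {x y} → homAny a c ds ≡ true → SatCs ds x y →
                   ∃ λ z → v a x z × Sat c z y
      SatAny-hom a c [] () _
      SatAny-hom a c ((a' , d) ∷ ds) h ((z , r , sat) , sats) with ∨-elim h
      ... | inj₁ q =
        z , subst (λ w → v w _ z) (sym (≟-sound (∧-fst q))) r , Sat-hom c d (∧-snd q) sat
      ... | inj₂ q = SatAny-hom a c ds q sats

    Sat-reduce⁻ : ∀ T {x y} → Sat (reduce T) x y → Sat T x y
    Sat-reduce⁻ T = Sat-hom T (reduce T) (hom-into-reduce T)

    Sat-reduce⁺ : ∀ T {x y} → Sat T x y → Sat (reduce T) x y
    Sat-reduce⁺ T = Sat-hom (reduce T) T (hom-from-reduce T)

    mutual
      Sat-unpointed : ∀ {T x y y'} → Unpointed T → Sat T x y → Sat T x y'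
      Sat-unpointed (unpointed us) (_ , sat) = (λ ()) , SatCs-unpointed us sat

      SatCs-unpointed : ∀ {cs x y y'} → UnpointedCs cs → SatCs cs x y → SatCs cs x y'
      SatCs-unpointed [] _ = tt
      SatCs-unpointed (u ∷ us) ((z , r , sat) , sats) =
        (z , r , Sat-unpointed u sat) , SatCs-unpointed us sats

    SatCs-++⁻ : ∀ cs {ds x y} → SatCs (cs ++ ds) x y → SatCs cs x y × SatCs ds x y
    SatCs-++⁻ [] sat = tt , sat
    SatCs-++⁻ (_ ∷ cs) (s₁ , sat) = let l , r = SatCs-++⁻ cs sat in (s₁ , l) , r

    SatCs-++⁺ : ∀ cs {ds x y} → SatCs cs x y → SatCs ds x y → SatCs (cs ++ ds) x y
    SatCs-++⁺ [] _ sat = sat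
    SatCs-++⁺ (_ ∷ cs) (s₁ , sat) sat' = s₁ , SatCs-++⁺ cs sat sat'

    mutual
      Sat-unpoint⁺ : ∀ T {x y z} → Sat T x z → Sat (unpoint T) x y
      Sat-unpoint⁺ (node b cs) (_ , sat) = (λ ()) , SatCs-unpoint⁺ cs sat

      SatCs-unpoint⁺ : ∀ cs {x y z} → SatCs cs x z → SatCs (unpointCs cs) x y
      SatCs-unpoint⁺ [] _ = tt
      SatCs-unpoint⁺ ((a , c) ∷ cs) ((w , r , sat) , sats) =
        (w , r , Sat-unpoint⁺ c sat) , SatCs-unpoint⁺ cs sats

    SatCs-unpointed-id : ∀ {cs x y} → UnpointedCs cs → SatCs (unpointCs cs) x y → SatCs cs x y
    SatCs-unpointed-id {x = x} {y} us = subst (λ L → SatCs L x y) (unpointCs-id us)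

    mutual
      Sat-unpoint⁻ : ∀ {T x y} → Pointed T → Sat (unpoint T) x y → ∃ λ z → Sat T x z
      Sat-unpoint⁻ {x = x} (at-root us) (_ , sat) =
        x , (λ _ → refl) , SatCs-unpointed us (SatCs-unpointed-id us sat)
      Sat-unpoint⁻ (below-root p) (_ , sat) = let z , sat' = SatCs-unpoint⁻ p sat in z , (λ ()) , sat'

      SatCs-unpoint⁻ : ∀ {cs x y} → PointedCs cs → SatCs (unpointCs cs) x y →
                       ∃ λ z → SatCs cs x z
      SatCs-unpoint⁻ (here p us) ((w , r , sat) , sats) =
        let z , sat' = Sat-unpoint⁻ p sat
        in z , (w , r , sat') , SatCs-unpointed us (SatCs-unpointed-id us sats)
      SatCs-unpoint⁻ (there u p) ((w , r , sat) , sats) =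
        let z , sats' = SatCs-unpoint⁻ p sats
        in z , (w , r , Sat-unpointed u (subst (λ T → Sat T w _) (unpoint-id u) sat)) , sats'

    mutual
      Sat-glue⁻ : ∀ {T} → Pointed T → ∀ S {x y} → Sat (glue T S) x y →
                  ∃ λ z → Sat T x z × Sat S z y
      Sat-glue⁻ (at-root {cs} us) (node b ds) {x} (pt , sat) =
        let sat₁ , sat₂ = SatCs-++⁻ cs sat
        in x , ((λ _ → refl) , SatCs-unpointed us sat₁) , (pt , sat₂)
      Sat-glue⁻ (below-root p) S (_ , sat) =
        let z , sat₁ , sat₂ = SatCs-glue⁻ p S sat in z , ((λ ()) , sat₁) , sat₂

      SatCs-glue⁻ : ∀ {cs} → PointedCs cs → ∀ S {x y} → SatCs (glueCs cs S) x y →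
                    ∃ λ z → SatCs cs x z × Sat S z y
      SatCs-glue⁻ (here p us) S {x} ((w , r , sat) , sats) =
        let z , satT , satS = Sat-glue⁻ p S sat
        in z , ((w , r , satT) , SatCs-unpointed us (subst (λ L → SatCs L x _) (glueCs-id S us) sats)) , satS
      SatCs-glue⁻ (there u p) S ((w , r , sat) , sats) =
        let z , satT , satS = SatCs-glue⁻ p S sats
        in z , ((w , r , Sat-unpointed u (subst (λ T → Sat T w _) (glue-id S u) sat)) , satT) , satS

    mutual
      Sat-glue⁺ : ∀ {T} → Pointed T → ∀ S {x y z} → Sat T x z → Sat S z y → Sat (glue T S) x y
      Sat-glue⁺ (at-root {cs} us) (node b ds) (pt₁ , sat₁) (pt₂ , sat₂) with pt₁ refl
      ... | refl = pt₂ , SatCs-++⁺ cs (SatCs-unpointed us sat₁) sat₂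
      Sat-glue⁺ (below-root p) S (_ , sat₁) sat₂ = (λ ()) , SatCs-glue⁺ p S sat₁ sat₂

      SatCs-glue⁺ : ∀ {cs} → PointedCs cs → ∀ S {x y z} → SatCs cs x z → Sat S z y →
                    SatCs (glueCs cs S) x y
      SatCs-glue⁺ (here p us) S {x} ((w , r , satT) , sats) satS =
        (w , r , Sat-glue⁺ p S satT satS) ,
        subst (λ L → SatCs L x _) (sym (glueCs-id S us)) (SatCs-unpointed us sats)
      SatCs-glue⁺ (there u p) S ((w , r , satT) , sats) satS =
        (w , r , subst (λ T → Sat T w _) (sym (glue-id S u)) (Sat-unpointed u satT)) ,
        SatCs-glue⁺ p S sats satS

    Sat-⨟⁺ : ∀ {T} → Pointed T → ∀ S {x y z} → Sat T x z → Sat S z y → Sat (T ⨟ S) x y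
    Sat-⨟⁺ {T} p S satT satS = Sat-reduce⁺ (glue T S) (Sat-glue⁺ p S satT satS)

    Sat-⨟⁻ : ∀ {T} → Pointed T → ∀ S {x y} → Sat (T ⨟ S) x y →
             ∃ λ z → Sat T x z × Sat S z y
    Sat-⨟⁻ {T} p S sat = Sat-glue⁻ p S (Sat-reduce⁻ (glue T S) sat)

    Sat-D⁺ : ∀ T {x z} → Sat T x z → Sat (Dᵗ T) x x
    Sat-D⁺ (node b cs) sat =
      Sat-reduce⁺ (node true (unpointCs cs)) ((λ _ → refl) , proj₂ (Sat-unpoint⁺ (node b cs) sat))

    Sat-D⁻ : ∀ {T} → Pointed T → ∀ {x y} → Sat (Dᵗ T) x y → x ≡ y × ∃ λ z → Sat T x z
    Sat-D⁻ {node b cs} p sat =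
      let pt , sats = Sat-reduce⁻ (node true (unpointCs cs)) sat
      in pt refl , Sat-unpoint⁻ p ((λ ()) , sats)

    ⟦⟧⇒Sat : ∀ s {x y} → ⟦ s ⟧ v x y → Sat (Tr s) x y
    ⟦⟧⇒Sat (var a) {y = y} r = (λ ()) , (y , r , (λ _ → refl) , tt) , tt
    ⟦⟧⇒Sat (s ⨾ t) (z , p , q) = Sat-⨟⁺ (Tr-pointed s) (Tr t) (⟦⟧⇒Sat s p) (⟦⟧⇒Sat t q)
    ⟦⟧⇒Sat one e = (λ _ → e) , tt
    ⟦⟧⇒Sat (D s) (refl , z , r) = Sat-D⁺ (Tr s) (⟦⟧⇒Sat s r)

    Sat⇒⟦⟧ : ∀ s {x y} → Sat (Tr s) x y → ⟦ s ⟧ v x y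
    Sat⇒⟦⟧ (var a) {x} (_ , (z , r , pt , _) , _) = subst (v a x) (pt refl) r
    Sat⇒⟦⟧ (s ⨾ t) sat =
      let z , sat₁ , sat₂ = Sat-⨟⁻ (Tr-pointed s) (Tr t) sat
      in z , Sat⇒⟦⟧ s sat₁ , Sat⇒⟦⟧ t sat₂
    Sat⇒⟦⟧ one (pt , _) = pt refl
    Sat⇒⟦⟧ (D s) sat =
      let x≡y , z , satT = Sat-D⁻ (Tr-pointed s) sat in x≡y , z , Sat⇒⟦⟧ s satT

  canonical : A → BinRel (Tree A)
  canonical a (node _ cs) S' = (a , S') ∈ cs

  open Semantics canonical

  mutual
    pointChildren : ∀ {T} → Pointed T → List Child
    pointChildren (at-root {cs} _) = cs
    pointChildren (below-root p) = pointChildrenCs p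

    pointChildrenCs : ∀ {cs} → PointedCs cs → List Child
    pointChildrenCs (here p _) = pointChildren p
    pointChildrenCs (there _ p) = pointChildrenCs p

  -- The argument  sub : xs ⊆ full  records
  -- that xs lists children of the vertex  node b full  the list is mapped to.
  mutual
    Sat-self-unpointed : ∀ {T} → Unpointed T → ∀ y → Sat T T y
    Sat-self-unpointed (unpointed us) y = (λ ()) , SatCs-self-unpointed us (λ m → m)

    SatCs-self-unpointed : ∀ {xs b full y} → UnpointedCs xs → (∀ {x} → x ∈ xs → x ∈ full) →
                           SatCs xs (node b full) y
    SatCs-self-unpointed [] sub = tt
    SatCs-self-unpointed {y = y} (_∷_ {c = c} u us) sub =
      (c , sub (here refl) , Sat-self-unpointed u y) , SatCs-self-unpointed us (λ m → sub (there m))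

  mutual
    Sat-self : ∀ {T} (p : Pointed T) → Sat T T (node true (pointChildren p))
    Sat-self (at-root us) = (λ _ → refl) , SatCs-self-unpointed us (λ m → m)
    Sat-self (below-root p) = (λ ()) , SatCs-self p (λ m → m)

    SatCs-self : ∀ {xs b full} (p : PointedCs xs) → (∀ {x} → x ∈ xs → x ∈ full) →
                 SatCs xs (node b full) (node true (pointChildrenCs p))
    SatCs-self (here {c = c} p us) sub =
      (c , sub (here refl) , Sat-self p) , SatCs-self-unpointed us (λ m → sub (there m))
    SatCs-self (there {c = c} u p) sub =
      (c , sub (here refl) , Sat-self-unpointed u _) , SatCs-self p (λ m → sub (there m))

  point-preserved : ∀ b {b' : Bool} {ds ys : List Child} →
                    (b ≡ true → node b' ds ≡ node true ys) → b ⇒ b' ≡ true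
  point-preserved false _ = refl
  point-preserved true pt with pt refl
  ... | refl = refl

  mutual
    Sat⇒hom : ∀ T S {ys} → Sat T S (node true ys) → hom T S ≡ true
    Sat⇒hom (node b cs) (node b' ds) (pt , sat) = ∧-intro (point-preserved b pt) (SatCs⇒homAll cs sat)

    SatCs⇒homAll : ∀ cs {b' ds ys} → SatCs cs (node b' ds) (node true ys) → homAll cs ds ≡ true
    SatCs⇒homAll [] _ = refl
    SatCs⇒homAll ((a , c) ∷ cs) ((z , z∈ , sat) , sats) =
      ∧-intro (homAny-intro z∈ (Sat⇒hom c z sat)) (SatCs⇒homAll cs sats)

  -- If Rel(;,1,D) ⊨ s = t then Tr t maps into Tr s: evaluate s = t in the
  -- canonical model at the identity image of Tr s.
  valid⇒hom : ∀ s t → RelValid s t → hom (Tr t) (Tr s) ≡ true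
  valid⇒hom s t valid =
    Sat⇒hom (Tr t) (Tr s) (⟦⟧⇒Sat t (s⇒t (Sat⇒⟦⟧ s (Sat-self p))))
    where
      p : Pointed (Tr s)
      p = Tr-pointed s
      point : Tree A
      point = node true (pointChildren p)
      s⇒t : ⟦ s ⟧ canonical (Tr s) point → ⟦ t ⟧ canonical (Tr s) point
      s⇒t = proj₁ (valid (Tree A) canonical (Tr s) point)

lemma4p5 : {A : Set} (_≟_ : DecidableEquality A) (s t : Term A) →
    RelValid s t → Trees._≈_ _≟_ (Trees.Tr _≟_ s) (Trees.Tr _≟_ t)
lemma4p5 _≟_ s t valid =
  hom-equivalent-reduced (Tr s) (Tr t) (Tr-reduced s) (Tr-reduced t)
    (valid⇒hom t s (RelValid-sym s t valid)) (valid⇒hom s t valid)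
  where
    open Trees _≟_ using (Tr)
    open SingleTree _≟_
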